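{- Let $n\in\mathbb{N}$ and let $A(p)$ be an $\mathcal{L}'$-formula modalized in $p$. Then there is an $\mathcal{L}$-formula $B$ containing only predicate symbols and free variables occurring in $A(p)$ such that $$\mathbf{QK}\vdash \Box^{n+1}\bot\to(B\leftrightarrow A(B)).$$ Moreover, such a formula $B$ is effectively calculable from $A(p)$.
   Context: Language $\mathcal{L}$: countably many individual variables, Boolean constants $\top,\bot$, connectives $\neg,\to$, quantifier $\forall$, modal operator $\Box$, countably many predicate symbols of each arity. Formulas: $\top$, $\bot$, $P(u_1,\ldots,u_n)$, closed under $\neg$, $\to$, $\forall u$, $\Box$. $\Box^{k}A$ denotes $A$ prefixed by $k$ boxes. $\mathcal{L}'$ is $\mathcal{L}$ together with one fixed propositional variable $p$. For an $\mathcal{L}'$-formula $A(p)$ and $\mathcal{L}$-formula $B$, $A(B)$ is the result of replacing every occurrence of $p$ by $B$. $A(p)$ is modalized in $p$ if every occurrence of $p$ lies within the scope of a $\Box$. $\mathbf{QK}$ is the predicate modal logic axiomatized by all instances (in the modal language) of the axioms of classical first-order predicate logic and $\Box(A\to B)\to(\Box A\to\Box B)$, with the rules of predicate logic (modus ponens and generalization) and necessitation $A/\Box A$. -}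

module Defs where

open import Data.Nat using (ℕ; zero; suc)
open import Data.Nat using (_≟_)
open import Data.Bool using (Bool; true; false; not; _∧_; _∨_; if_then_else_)
open import Data.Vec using (Vec; map)
open import Data.Vec.Relation.Unary.Any using (Any)
open import Data.Product using (_×_; _,_)
open import Data.Sum using (_⊎_)
open import Data.Unit using (⊤)
open import Data.Empty renaming (⊥ to Empty)
open import Relation.Nullary using (¬_; yes; no)
open import Relation.Binary.PropositionalEquality using (_≡_)

Var : Set
Var = ℕ

infixr 5 _⇒_

-- The language L: predicate symbols are indexed by (arity k, index i).

data Fm : Set where
  ⊤ᶠ  : Fm
  ⊥ᶠ  : Fm
  Pr  : (k i : ℕ) → Vec Var k → Fm
  ¬ᶠ  : Fm → Fm
  _⇒_ : Fm → Fm → Fm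
  ∀ᶠ  : Var → Fm → Fm
  □   : Fm → Fm

-- The language L' = L plus one propositional variable p.
data Fm' : Set where
  ⊤ᶠ  : Fm'
  ⊥ᶠ  : Fm'
  Pr  : (k i : ℕ) → Vec Var k → Fm'
  pv  : Fm'
  ¬ᶠ  : Fm' → Fm'
  _⇒_ : Fm' → Fm' → Fm'
  ∀ᶠ  : Var → Fm' → Fm'
  □   : Fm' → Fm'

□^ : ℕ → Fm → Fm
□^ zero    A = A
□^ (suc k) A = □ (□^ k A)

_∧ᶠ_ : Fm → Fm → Fm
A ∧ᶠ B = ¬ᶠ (A ⇒ ¬ᶠ B)

_⇔_ : Fm → Fm → Fm
A ⇔ B = (A ⇒ B) ∧ᶠ (B ⇒ A)

_[_] : Fm' → Fm → Fm
⊤ᶠ [ B ] = ⊤ᶠ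
⊥ᶠ [ B ] = ⊥ᶠ
Pr k i us [ B ] = Pr k i us
pv [ B ] = B
¬ᶠ A [ B ] = ¬ᶠ (A [ B ])
(A ⇒ C) [ B ] = (A [ B ]) ⇒ (C [ B ])
∀ᶠ u A [ B ] = ∀ᶠ u (A [ B ])
□ A [ B ] = □ (A [ B ])

Modalized : Fm' → Set
Modalized ⊤ᶠ = ⊤
Modalized ⊥ᶠ = ⊤
Modalized (Pr k i us) = ⊤
Modalized pv = Empty
Modalized (¬ᶠ A) = Modalized A
Modalized (A ⇒ C) = Modalized A × Modalized C
Modalized (∀ᶠ u A) = Modalized A
Modalized (□ A) = ⊤

Free : Var → Fm → Set
Free x ⊤ᶠ = Empty
Free x ⊥ᶠ = Empty
Free x (Pr k i us) = Any (x ≡_) us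
Free x (¬ᶠ A) = Free x A
Free x (A ⇒ C) = Free x A ⊎ Free x C
Free x (∀ᶠ u A) = (¬ u ≡ x) × Free x A
Free x (□ A) = Free x A

Free' : Var → Fm' → Set
Free' x ⊤ᶠ = Empty
Free' x ⊥ᶠ = Empty
Free' x (Pr k i us) = Any (x ≡_) us
Free' x pv = Empty
Free' x (¬ᶠ A) = Free' x A
Free' x (A ⇒ C) = Free' x A ⊎ Free' x C
Free' x (∀ᶠ u A) = (¬ u ≡ x) × Free' x A
Free' x (□ A) = Free' x A

OccP : ℕ → ℕ → Fm → Set
OccP k i ⊤ᶠ = Empty
OccP k i ⊥ᶠ = Empty
OccP k i (Pr k' i' us) = (k ≡ k') × (i ≡ i')
OccP k i (¬ᶠ A) = OccP k i A
OccP k i (A ⇒ C) = OccP k i A ⊎ OccP k i C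
OccP k i (∀ᶠ u A) = OccP k i A
OccP k i (□ A) = OccP k i A

OccP' : ℕ → ℕ → Fm' → Set
OccP' k i ⊤ᶠ = Empty
OccP' k i ⊥ᶠ = Empty
OccP' k i (Pr k' i' us) = (k ≡ k') × (i ≡ i')
OccP' k i pv = Empty
OccP' k i (¬ᶠ A) = OccP' k i A
OccP' k i (A ⇒ C) = OccP' k i A ⊎ OccP' k i C
OccP' k i (∀ᶠ u A) = OccP' k i A
OccP' k i (□ A) = OccP' k i A

-- Substitution of variable y for the free occurrences of x (no renaming),
-- and the condition "y is free for x in A".

renV : Var → Var → Var → Var
renV x y u with u ≟ x
... | yes _ = y
... | no  _ = u

sub : Var → Var → Fm → Fm
sub x y ⊤ᶠ = ⊤ᶠ
sub x y ⊥ᶠ = ⊥ᶠ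
sub x y (Pr k i us) = Pr k i (map (renV x y) us)
sub x y (¬ᶠ A) = ¬ᶠ (sub x y A)
sub x y (A ⇒ C) = sub x y A ⇒ sub x y C
sub x y (∀ᶠ u A) with u ≟ x
... | yes _ = ∀ᶠ u A
... | no  _ = ∀ᶠ u (sub x y A)
sub x y (□ A) = □ (sub x y A)

FreeFor : Var → Var → Fm → Set
FreeFor y x ⊤ᶠ = ⊤
FreeFor y x ⊥ᶠ = ⊤
FreeFor y x (Pr k i us) = ⊤
FreeFor y x (¬ᶠ A) = FreeFor y x A
FreeFor y x (A ⇒ C) = FreeFor y x A × FreeFor y x C
FreeFor y x (∀ᶠ u A) = (¬ Free x (∀ᶠ u A)) ⊎ ((¬ u ≡ y) × FreeFor y x A)
FreeFor y x (□ A) = FreeFor y x A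

-- Propositional tautologies (instances of classical propositional
-- tautologies in the modal language): atoms, ∀-formulas and □-formulas
-- are treated as propositional atoms.

eval : (Fm → Bool) → Fm → Bool
eval v ⊤ᶠ = true
eval v ⊥ᶠ = false
eval v (Pr k i us) = v (Pr k i us)
eval v (¬ᶠ A) = not (eval v A)
eval v (A ⇒ C) = not (eval v A) ∨ eval v C
eval v (∀ᶠ u A) = v (∀ᶠ u A)
eval v (□ A) = v (□ A)

Tautology : Fm → Set
Tautology A = (v : Fm → Bool) → eval v A ≡ true

infix 2 QK⊢_

data QK⊢_ : Fm → Set where
  taut   : ∀ {A} → Tautology A → QK⊢ A
  ax-∀E  : ∀ {A x y} → FreeFor y x A → QK⊢ (∀ᶠ x A ⇒ sub x y A)
  ax-∀I  : ∀ {A x} → ¬ Free x A → QK⊢ (A ⇒ ∀ᶠ x A)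
  ax-∀K  : ∀ {A C x} → QK⊢ (∀ᶠ x (A ⇒ C) ⇒ (∀ᶠ x A ⇒ ∀ᶠ x C))
  ax-K   : ∀ {A C} → QK⊢ (□ (A ⇒ C) ⇒ (□ A ⇒ □ C))
  mp     : ∀ {A C} → QK⊢ (A ⇒ C) → QK⊢ A → QK⊢ C
  gen    : ∀ {A} x → QK⊢ A → QK⊢ ∀ᶠ x A
  nec    : ∀ {A} → QK⊢ A → QK⊢ □ A

module Submission where

-- Iterate A starting from ⊤:  B₀ = ⊤,  Bₖ₊₁ = A(Bₖ).  Since A is
-- modalized in p, a difference between C and D at modal depth j can only
-- surface in A(C), A(D) one □ deeper; as □ʲ⊥ kills every difference below
-- depth j we obtain   QK ⊢ □ᵏ⊥ → (Bₖ ↔ Bₖ₊₁)   by induction on k, and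
-- B = Bₙ₊₁ is the required fixed point: Bₙ₊₂ is literally A(B).
--
-- The construction of B is an explicit recursive function of A, which is the
-- effectiveness clause of the informal statement.

open import Defs
open import Data.Nat using (ℕ; suc; zero)
open import Data.Bool using (Bool; true; false; not; _∨_)
open import Data.Bool.Properties using (∨-zeroʳ; ∨-inverseˡ)
open import Data.Product using (Σ; _×_; _,_)
open import Data.Sum using (_⊎_; inj₁; inj₂; map₁; [_,_]′)
open import Function using (id)
open import Relation.Nullary using (¬_)
open import Relation.Binary.PropositionalEquality
  using (_≡_; refl; sym; trans; cong; cong₂; subst)

_⊢_ : Fm → Fm → Set
H ⊢ X = QK⊢ (H ⇒ X)

_⊨_ : (Fm → Bool) → Fm → Set
v ⊨ X = eval v X ≡ true

⇔-sound : ∀ v X Y → v ⊨ (X ⇔ Y) → eval v X ≡ eval v Y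
⇔-sound v X Y h with eval v X | eval v Y | h
... | true  | true  | _  = refl
... | false | false | _  = refl
... | true  | false | ()
... | false | true  | ()

⇔-complete : ∀ v X Y → eval v X ≡ eval v Y → v ⊨ (X ⇔ Y)
⇔-complete v X Y eq rewrite eq with eval v Y
... | true  = refl
... | false = refl

⇒-antisym : ∀ x y → not x ∨ y ≡ true → not y ∨ x ≡ true → x ≡ y
⇒-antisym true  true  _  _  = refl
⇒-antisym false false _  _  = refl
⇒-antisym true  false () _
⇒-antisym false true  _  ()

semantic₂ : ∀ {H X Y Z} → (∀ v → v ⊨ X → v ⊨ Y → v ⊨ Z) →
            H ⊢ X → H ⊢ Y → H ⊢ Z
semantic₂ {H} {X} {Y} {Z} valid p q = mp (mp (taut relativised) p) q
  where
  relativised : Tautology ((H ⇒ X) ⇒ ((H ⇒ Y) ⇒ (H ⇒ Z)))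
  relativised v with eval v H | eval v X in x | eval v Y in y
  ... | false | _     | _     = refl
  ... | true  | false | _     = refl
  ... | true  | true  | false = refl
  ... | true  | true  | true  = valid v x y

semantic₁ : ∀ {H X Z} → (∀ v → v ⊨ X → v ⊨ Z) → H ⊢ X → H ⊢ Z
semantic₁ valid p = semantic₂ (λ v x _ → valid v x) p p

semantic₀ : ∀ {H X} → (∀ v → v ⊨ X) → H ⊢ X
semantic₀ {H} valid = taut λ v → trans (cong (not (eval v H) ∨_) (valid v)) (∨-zeroʳ _)

⊥-explodes : ∀ X → ⊥ᶠ ⊢ X
⊥-explodes X = taut λ v → refl

weaken : ∀ {H X} → QK⊢ X → H ⊢ X
weaken {H} {X} p = mp (taut axiom-K) p
  where
  axiom-K : Tautology (X ⇒ (H ⇒ X))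
  axiom-K v with eval v X
  ... | false = refl
  ... | true  = ∨-zeroʳ _

mp-under : ∀ {H X Y} → H ⊢ X → H ⊢ (X ⇒ Y) → H ⊢ Y
mp-under {Y = Y} = semantic₂ λ v x xy → subst (λ b → not b ∨ eval v Y ≡ true) x xy

⇒-trans : ∀ {X Y Z} → QK⊢ (X ⇒ Y) → QK⊢ (Y ⇒ Z) → QK⊢ (X ⇒ Z)
⇒-trans p q = mp-under p (weaken q)

⇔-refl : ∀ {H} X → H ⊢ (X ⇔ X)
⇔-refl X = semantic₀ λ v → ⇔-complete v X X refl

⇔-forward : ∀ {H X Y} → H ⊢ (X ⇔ Y) → H ⊢ (X ⇒ Y)
⇔-forward {X = X} {Y} = semantic₁ λ v e →
  subst (λ b → not (eval v X) ∨ b ≡ true) (⇔-sound v X Y e) (∨-inverseˡ (eval v X))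

⇔-backward : ∀ {H X Y} → H ⊢ (X ⇔ Y) → H ⊢ (Y ⇒ X)
⇔-backward {X = X} {Y} = semantic₁ λ v e →
  subst (λ b → not (eval v Y) ∨ b ≡ true) (sym (⇔-sound v X Y e)) (∨-inverseˡ (eval v Y))

⇔-intro : ∀ {H X Y} → H ⊢ (X ⇒ Y) → H ⊢ (Y ⇒ X) → H ⊢ (X ⇔ Y)
⇔-intro {X = X} {Y} = semantic₂ λ v xy yx →
  ⇔-complete v X Y (⇒-antisym (eval v X) (eval v Y) xy yx)

¬-cong : ∀ {H X Y} → H ⊢ (X ⇔ Y) → H ⊢ (¬ᶠ X ⇔ ¬ᶠ Y)
¬-cong {X = X} {Y} = semantic₁ λ v e →
  ⇔-complete v (¬ᶠ X) (¬ᶠ Y) (cong not (⇔-sound v X Y e))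

⇒-cong : ∀ {H X Y Z W} → H ⊢ (X ⇔ Y) → H ⊢ (Z ⇔ W) → H ⊢ ((X ⇒ Z) ⇔ (Y ⇒ W))
⇒-cong {X = X} {Y} {Z} {W} = semantic₂ λ v e₁ e₂ →
  ⇔-complete v (X ⇒ Z) (Y ⇒ W)
    (cong₂ (λ a b → not a ∨ b) (⇔-sound v X Y e₁) (⇔-sound v Z W e₂))

-- ∀ is monotone under a hypothesis in which x is not free: generalise the
-- hypothesis, then distribute ∀ over the two implications.
∀-mono : ∀ {H E F} x → ¬ Free x H → H ⊢ (E ⇒ F) → H ⊢ (∀ᶠ x E ⇒ ∀ᶠ x F)
∀-mono x closed p = ⇒-trans (⇒-trans (ax-∀I closed) (mp ax-∀K (gen x p))) ax-∀K

∀-cong : ∀ {H E F} x → ¬ Free x H → H ⊢ (E ⇔ F) → H ⊢ (∀ᶠ x E ⇔ ∀ᶠ x F)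
∀-cong x closed p = ⇔-intro (∀-mono x closed (⇔-forward p)) (∀-mono x closed (⇔-backward p))

□-mono : ∀ {X Y} → QK⊢ (X ⇒ Y) → QK⊢ (□ X ⇒ □ Y)
□-mono p = mp ax-K (nec p)

□-cong : ∀ {H E F} → H ⊢ (E ⇔ F) → □ H ⊢ (□ E ⇔ □ F)
□-cong p = ⇔-intro (⇒-trans (□-mono (⇔-forward p)) ax-K)
                   (⇒-trans (□-mono (⇔-backward p)) ax-K)

□^⊥-closed : ∀ j x → ¬ Free x (□^ j ⊥ᶠ)
□^⊥-closed zero    x ()
□^⊥-closed (suc j) x f = □^⊥-closed j x f

□^⊥-step : ∀ j → □^ j ⊥ᶠ ⊢ □^ (suc j) ⊥ᶠ
□^⊥-step zero    = ⊥-explodes (□ ⊥ᶠ)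
□^⊥-step (suc j) = □-mono (□^⊥-step j)

-- Each □ in A consumes one level of the hypothesis; at level 0 the
-- hypothesis is ⊥ and there is nothing to prove.
replacement : ∀ (A : Fm') j {C D} → □^ j ⊥ᶠ ⊢ (C ⇔ D) →
              □^ j ⊥ᶠ ⊢ ((A [ C ]) ⇔ (A [ D ]))
replacement ⊤ᶠ          j       p = ⇔-refl ⊤ᶠ
replacement ⊥ᶠ          j       p = ⇔-refl ⊥ᶠ
replacement (Pr k i us) j       p = ⇔-refl (Pr k i us)
replacement pv          j       p = p
replacement (¬ᶠ A)      j       p = ¬-cong (replacement A j p)
replacement (A ⇒ A′)    j       p = ⇒-cong (replacement A j p) (replacement A′ j p)
replacement (∀ᶠ x A)    j       p = ∀-cong x (□^⊥-closed j x) (replacement A j p)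
replacement (□ A)       zero    {C} {D} p = ⊥-explodes (□ (A [ C ]) ⇔ □ (A [ D ]))
replacement (□ A)       (suc j) p = □-cong (replacement A j (⇒-trans (□^⊥-step j) p))

contraction : ∀ (A : Fm') → Modalized A → ∀ j {C D} → □^ j ⊥ᶠ ⊢ (C ⇔ D) →
              □^ (suc j) ⊥ᶠ ⊢ ((A [ C ]) ⇔ (A [ D ]))
contraction ⊤ᶠ          _         j p = ⇔-refl ⊤ᶠ
contraction ⊥ᶠ          _         j p = ⇔-refl ⊥ᶠ
contraction (Pr k i us) _         j p = ⇔-refl (Pr k i us)
contraction pv          ()
contraction (¬ᶠ A)      m         j p = ¬-cong (contraction A m j p)
contraction (A ⇒ A′)    (m , m′)  j p = ⇒-cong (contraction A m j p) (contraction A′ m′ j p)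
contraction (∀ᶠ x A)    m         j p = ∀-cong x (□^⊥-closed (suc j) x) (contraction A m j p)
contraction (□ A)       _         j p = □-cong (replacement A j p)

approximant : Fm' → ℕ → Fm
approximant A zero    = ⊤ᶠ
approximant A (suc k) = A [ approximant A k ]

approximants-stabilise : ∀ A → Modalized A → ∀ k →
  □^ k ⊥ᶠ ⊢ (approximant A k ⇔ approximant A (suc k))
approximants-stabilise A m zero    = ⊥-explodes (⊤ᶠ ⇔ (A [ ⊤ᶠ ]))
approximants-stabilise A m (suc k) = contraction A m k (approximants-stabilise A m k)

occP-subst : ∀ k i (A : Fm') B → OccP k i (A [ B ]) → OccP' k i A ⊎ OccP k i B
occP-subst k i ⊤ᶠ          B ()
occP-subst k i ⊥ᶠ          B ()
occP-subst k i (Pr _ _ _)  B o        = inj₁ o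
occP-subst k i pv          B o        = inj₂ o
occP-subst k i (¬ᶠ A)      B o        = occP-subst k i A B o
occP-subst k i (A ⇒ A′)    B (inj₁ o) = map₁ inj₁ (occP-subst k i A B o)
occP-subst k i (A ⇒ A′)    B (inj₂ o) = map₁ inj₂ (occP-subst k i A′ B o)
occP-subst k i (∀ᶠ _ A)    B o        = occP-subst k i A B o
occP-subst k i (□ A)       B o        = occP-subst k i A B o

free-subst : ∀ x (A : Fm') B → Free x (A [ B ]) → Free' x A ⊎ Free x B
free-subst x ⊤ᶠ         B ()
free-subst x ⊥ᶠ         B ()
free-subst x (Pr _ _ _) B f             = inj₁ f
free-subst x pv         B f             = inj₂ f
free-subst x (¬ᶠ A)     B f             = free-subst x A B f
free-subst x (A ⇒ A′)   B (inj₁ f)      = map₁ inj₁ (free-subst x A B f)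
free-subst x (A ⇒ A′)   B (inj₂ f)      = map₁ inj₂ (free-subst x A′ B f)
free-subst x (∀ᶠ u A)   B (u≢x , f)     = map₁ (u≢x ,_) (free-subst x A B f)
free-subst x (□ A)      B f             = free-subst x A B f

approximant-occP : ∀ A j k i → OccP k i (approximant A j) → OccP' k i A
approximant-occP A zero    k i ()
approximant-occP A (suc j) k i o =
  [ id , approximant-occP A j k i ]′ (occP-subst k i A (approximant A j) o)

approximant-free : ∀ A j x → Free x (approximant A j) → Free' x A
approximant-free A zero    x ()
approximant-free A (suc j) x f =
  [ id , approximant-free A j x ]′ (free-subst x A (approximant A j) f)

-- The fixed point is B = Bₙ₊₁, since Bₙ₊₂ is literally A(B).
theorem4p1 : (n : ℕ) (A : Fm') → Modalized A →
    Σ Fm (λ B →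
    ((k i : ℕ) → OccP k i B → OccP' k i A) ×
    ((x : ℕ) → Free x B → Free' x A) ×
    (QK⊢ (□^ (suc n) ⊥ᶠ ⇒ (B ⇔ (A [ B ])))))
theorem4p1 n A modalized =
  approximant A (suc n) ,
  approximant-occP A (suc n) ,
  approximant-free A (suc n) ,
  approximants-stabilise A modalized (suc n)
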